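{- Fix a positive integer $d$. For $n\ge0$ let $a_d(n)$ be the number of tuples $(k_1,\dots,k_d)$ of nonnegative integers with $k_1+\cdots+k_d=n$ and $k_j\le k_{j-1}+1$ for all $j\in\{2,\dots,d\}$ (equivalently, $a_d(n)$ is the coefficient of $q^n$ in $\sum_{k_1=0}^{\infty}\sum_{k_2=0}^{k_1+1}\cdots\sum_{k_d=0}^{k_{d-1}+1}q^{k_1+\cdots+k_d}$). Then, as $n\to\infty$, \[ a_d(n)=\frac{1}{d!}\,\frac{n^{d-1}}{(d-1)!}+O(n^{d-2}). \] -}

module Defs where

open import Data.Nat using (ℕ; zero; suc; _≤_; _≤?_; _≟_)
open import Data.Nat.Properties using ()
open import Data.Vec using (Vec; []; _∷_)
import Data.Vec as Vec
open import Data.List using (List; [_]; concatMap; map; upTo; filter; length)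
open import Data.Unit using (⊤; tt)
open import Data.Product using (_×_)
open import Relation.Binary.PropositionalEquality using (_≡_)
open import Relation.Nullary using (Dec; yes)
open import Relation.Nullary.Decidable using (_×-dec_)

Chain : ∀ {d} → Vec ℕ d → Set
Chain [] = ⊤
Chain (x ∷ []) = ⊤
Chain (x ∷ y ∷ v) = (y ≤ suc x) × Chain (y ∷ v)

chain? : ∀ {d} (v : Vec ℕ d) → Dec (Chain v)
chain? [] = yes tt
chain? (x ∷ []) = yes tt
chain? (x ∷ y ∷ v) = (y ≤? suc x) ×-dec chain? (y ∷ v)

Admissible : (d n : ℕ) → Vec ℕ d → Set
Admissible d n v = (Vec.sum v ≡ n) × Chain v

admissible? : (d n : ℕ) (v : Vec ℕ d) → Dec (Admissible d n v)
admissible? d n v = (Vec.sum v ≟ n) ×-dec chain? v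

-- All vectors of length d with every entry in {0,…,n} (each exactly once).
-- Any tuple with sum n has all entries ≤ n, so this list contains every
-- admissible tuple.
vecsUpTo : (d n : ℕ) → List (Vec ℕ d)
vecsUpTo zero n = [ [] ]
vecsUpTo (suc d) n = concatMap (λ k → map (k ∷_) (vecsUpTo d n)) (upTo (suc n))

a : ℕ → ℕ → ℕ
a d n = length (filter (admissible? d n) (vecsUpTo d n))

{-# OPTIONS --safe #-}
module Submission where

-- Adding d + 1 − j to the j-th entry turns a chain tuple (k_j ≤ k_{j−1} + 1) into a weakly
-- decreasing one, so a_d(n) lies between p_d(n) and p_d(n + d(d+1)/2), where p_d(m) counts the
-- partitions of m into at most d parts.  The q-Pascal rule p_d(m) = p_{d−1}(m) + p_d(m − d) and the
-- binomial bounds y^e + e·x·y^(e−1) ≤ (x + y)^e ≤ y^e + e·x·(x + y)^(e−1) give, by induction on d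
-- and m, m^(d−1) ≤ d!(d−1)! p_d(m) ≤ (m + d(d+1)/2)^(d−1).

open import Defs
open import Data.Bool using (true; false)
open import Data.Integer using (+_; _-_; ∣_∣)
import Data.Integer.Properties as ℤ
open import Data.List using (List; []; _∷_; applyUpTo; upTo; map; concatMap; filter; length; _++_)
open import Data.List.Properties using (filter-++; filter-none; filter-≐; length-++; map-upTo)
import Data.List.Relation.Unary.All as All
open import Data.Nat using (ℕ; zero; suc; _+_; _*_; _^_; _∸_; _!; _≤_; _<_; z≤n; s≤s; z<s; s<s; s≤s⁻¹; s<s⁻¹)
open import Data.Nat.ListAction using (sum)
open import Data.Nat.Properties
open import Algebra.Properties.CommutativeSemigroup +-commutativeSemigroup
  using () renaming (interchange to +-interchange; x∙yz≈y∙xz to +-left-comm)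
open import Data.Nat.Tactic.RingSolver using (solve-∀)
open import Data.Product using (∃₂; _×_; _,_)
open import Data.Sum using (inj₁; inj₂)
open import Data.Unit using (⊤; tt)
open import Data.Vec using (Vec; []; _∷_)
import Data.Vec as Vec
open import Function using (_∘_)
open import Function.Bundles using (_⇔_; mk⇔; Equivalence)
open import Level using (Level)
open import Relation.Binary.PropositionalEquality
open import Relation.Nullary using (¬_; Dec; yes; does)
open import Relation.Nullary.Decidable using (_×-dec_)
open import Relation.Unary using (Pred; Decidable)

∑ : ℕ → (ℕ → ℕ) → ℕ
∑ n f = sum (applyUpTo f n)

syntax ∑ n (λ k → e) = ∑[ k < n ] e

∑-cong : ∀ n {f g : ℕ → ℕ} → (∀ k → f k ≡ g k) → ∑ n f ≡ ∑ n g
∑-cong zero    f≡g = refl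
∑-cong (suc n) f≡g = cong₂ _+_ (f≡g 0) (∑-cong n (f≡g ∘ suc))

∑-mono : ∀ n {f g : ℕ → ℕ} → (∀ k → f k ≤ g k) → ∑ n f ≤ ∑ n g
∑-mono zero    f≤g = z≤n
∑-mono (suc n) f≤g = +-mono-≤ (f≤g 0) (∑-mono n (f≤g ∘ suc))

∑-zero : ∀ n {f : ℕ → ℕ} → (∀ k → f k ≡ 0) → ∑ n f ≡ 0
∑-zero zero    f≡0 = refl
∑-zero (suc n) f≡0 = cong₂ _+_ (f≡0 0) (∑-zero n (f≡0 ∘ suc))

∑-distrib-+ : ∀ n (f g : ℕ → ℕ) → ∑[ k < n ] (f k + g k) ≡ ∑ n f + ∑ n g
∑-distrib-+ zero    f g = refl
∑-distrib-+ (suc n) f g = begin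
  f 0 + g 0 + ∑[ k < n ] (f (suc k) + g (suc k))
    ≡⟨ cong (λ s → f 0 + g 0 + s) (∑-distrib-+ n (f ∘ suc) (g ∘ suc)) ⟩
  f 0 + g 0 + (∑ n (f ∘ suc) + ∑ n (g ∘ suc))
    ≡⟨ +-interchange (f 0) (g 0) _ _ ⟩
  f 0 + ∑ n (f ∘ suc) + (g 0 + ∑ n (g ∘ suc)) ∎
  where open ≡-Reasoning

∑-prefix-≤ : ∀ {n n′} (f : ℕ → ℕ) → n ≤ n′ → ∑ n f ≤ ∑ n′ f
∑-prefix-≤ f z≤n       = z≤n
∑-prefix-≤ f (s≤s n≤n′) = +-monoʳ-≤ (f 0) (∑-prefix-≤ (f ∘ suc) n≤n′)

∑-suffix-≤ : ∀ s n (f : ℕ → ℕ) → ∑[ k < n ] f (s + k) ≤ ∑ (s + n) f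
∑-suffix-≤ zero    n f = ≤-refl
∑-suffix-≤ (suc s) n f = ≤-trans (∑-suffix-≤ s n (f ∘ suc)) (m≤n+m _ (f 0))

∑-restrict : ∀ M b {g h : ℕ → ℕ} → (∀ k → k ≤ b → g k ≡ h k) →
             (∀ k → b < k → g k ≡ 0) → (∀ k → M < k → h k ≡ 0) →
             ∑ (suc M) g ≡ ∑ (suc b) h
∑-restrict M       zero    g≡h g≡0 h≡0 =
  cong₂ _+_ (g≡h 0 z≤n) (∑-zero M (λ k → g≡0 (suc k) z<s))
∑-restrict zero    (suc b) g≡h g≡0 h≡0 =
  cong₂ _+_ (g≡h 0 z≤n) (sym (∑-zero (suc b) (λ k → h≡0 (suc k) z<s)))
∑-restrict (suc M) (suc b) g≡h g≡0 h≡0 =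
  cong₂ _+_ (g≡h 0 z≤n)
    (∑-restrict M b (λ k → g≡h (suc k) ∘ s≤s) (λ k → g≡0 (suc k) ∘ s<s)
                    (λ k → h≡0 (suc k) ∘ s<s))

δ : ℕ → ℕ
δ zero    = 1
δ (suc _) = 0

-- shift s f is the coefficient sequence of q^s · Σₘ f(m) qᵐ.
shift : ℕ → (ℕ → ℕ) → ℕ → ℕ
shift zero    f m       = f m
shift (suc s) f zero    = 0
shift (suc s) f (suc m) = shift s f m

shift-cong : ∀ s {f g : ℕ → ℕ} m → (∀ x → x ≤ m → f x ≡ g x) → shift s f m ≡ shift s g m
shift-cong zero    m       f≡g = f≡g m ≤-refl
shift-cong (suc s) zero    f≡g = refl
shift-cong (suc s) (suc m) f≡g = shift-cong s m (λ x x≤m → f≡g x (m≤n⇒m≤1+n x≤m))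

shift-mono : ∀ s {f g : ℕ → ℕ} m → (∀ x → f x ≤ g x) → shift s f m ≤ shift s g m
shift-mono zero    m       f≤g = f≤g m
shift-mono (suc s) zero    f≤g = z≤n
shift-mono (suc s) (suc m) f≤g = shift-mono s m f≤g

shift-below : ∀ s {f : ℕ → ℕ} {m} → m < s → shift s f m ≡ 0
shift-below (suc s) {m = zero}  m<s = refl
shift-below (suc s) {m = suc m} m<s = shift-below s (s<s⁻¹ m<s)

shift-+ˡ : ∀ s {f : ℕ → ℕ} x → shift s f (s + x) ≡ f x
shift-+ˡ zero    x = refl
shift-+ˡ (suc s) x = shift-+ˡ s x

shift-cancelˡ : ∀ s k {f : ℕ → ℕ} x → shift (s + k) f (s + x) ≡ shift k f x
shift-cancelˡ zero    k x = refl
shift-cancelˡ (suc s) k x = shift-cancelˡ s k x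

shift-shift : ∀ s t {f : ℕ → ℕ} m → shift s (shift t f) m ≡ shift (s + t) f m
shift-shift zero    t m       = refl
shift-shift (suc s) t zero    = refl
shift-shift (suc s) t (suc m) = shift-shift s t m

shift-distrib-+ : ∀ s (f g : ℕ → ℕ) m → shift s (λ x → f x + g x) m ≡ shift s f m + shift s g m
shift-distrib-+ zero    f g m       = refl
shift-distrib-+ (suc s) f g zero    = refl
shift-distrib-+ (suc s) f g (suc m) = shift-distrib-+ s f g m

shift-∑ : ∀ s n (F : ℕ → ℕ → ℕ) m →
          shift s (λ x → ∑[ k < n ] F k x) m ≡ ∑[ k < n ] shift s (F k) m
shift-∑ zero    n F m       = refl
shift-∑ (suc s) n F zero    = sym (∑-zero n (λ _ → refl))
shift-∑ (suc s) n F (suc m) = shift-∑ s n F m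

*-shift : ∀ c s {f : ℕ → ℕ} m → c * shift s f m ≡ shift s (λ x → c * f x) m
*-shift c zero    m       = refl
*-shift c (suc s) zero    = *-zeroʳ c
*-shift c (suc s) (suc m) = *-shift c s m

shift-≤ : ∀ s {f g : ℕ → ℕ} m → (∀ x → f x ≤ g (s + x)) → shift s f m ≤ g m
shift-≤ zero    m       f≤g = f≤g m
shift-≤ (suc s) zero    f≤g = z≤n
shift-≤ (suc s) {g = g} (suc m) f≤g = shift-≤ s {g = g ∘ suc} m f≤g

shift-+ʳ-≤ : ∀ s {f : ℕ → ℕ} m c → shift s (λ x → f (x + c)) m ≤ shift s f (m + c)
shift-+ʳ-≤ zero    m       c = ≤-refl
shift-+ʳ-≤ (suc s) zero    c = z≤n
shift-+ʳ-≤ (suc s) (suc m) c = shift-+ʳ-≤ s m c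

-- partitions d b m counts the weakly decreasing d-tuples with first entry ≤ b and sum m (the
-- coefficient of qᵐ in the Gaussian binomial [d+b, d]_q); chains d b m counts the chain tuples
-- (k_j ≤ k_{j−1} + 1) with first entry ≤ b and sum m.
partitions : ℕ → ℕ → ℕ → ℕ
partitions zero    b = δ
partitions (suc d) b m = ∑[ k < suc b ] shift k (partitions d k) m

chains : ℕ → ℕ → ℕ → ℕ
chains zero    b = δ
chains (suc d) b m = ∑[ k < suc b ] shift k (chains d (suc k)) m

triangle : ℕ → ℕ
triangle zero    = 0
triangle (suc d) = suc d + triangle d

partitions-zero : ∀ d m → partitions (suc d) 0 m ≡ partitions d 0 m
partitions-zero d m = +-identityʳ (partitions d 0 m)

partitions-pascal : ∀ d b m →
  partitions (suc d) (suc b) m ≡ partitions d (suc b) m + shift (suc d) (partitions (suc d) b) m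
partitions-pascal zero b m = cong (λ x → δ m + x) (begin
  ∑[ k < suc b ] shift (suc k) δ m       ≡⟨ ∑-cong (suc b) (λ k → sym (shift-shift 1 k {δ} m)) ⟩
  ∑[ k < suc b ] shift 1 (shift k δ) m   ≡⟨ shift-∑ 1 (suc b) (λ k → shift k δ) m ⟨
  shift 1 (partitions 1 b) m             ∎)
  where open ≡-Reasoning
partitions-pascal (suc d) b m = begin
  p′ 0 m + ∑[ k < suc b ] shift (suc k) (p′ (suc k)) m
    ≡⟨ cong₂ _+_ (partitions-zero d m)
                 (∑-cong (suc b) (λ k → shift-cong (suc k) m (λ x _ → partitions-pascal d k x))) ⟩
  p 0 m + ∑[ k < suc b ] shift (suc k) (λ x → p (suc k) x + shift (suc d) (p′ k) x) m
    ≡⟨ cong (λ x → p 0 m + x) (trans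
         (∑-cong (suc b) (λ k → shift-distrib-+ (suc k) (p (suc k)) (shift (suc d) (p′ k)) m))
         (∑-distrib-+ (suc b) (λ k → shift (suc k) (p (suc k)) m) (λ k → shift (suc k) (shift (suc d) (p′ k)) m))) ⟩
  p 0 m + (∑[ k < suc b ] shift (suc k) (p (suc k)) m + ∑[ k < suc b ] shift (suc k) (shift (suc d) (p′ k)) m)
    ≡⟨ +-assoc (p 0 m) _ _ ⟨
  p′ (suc b) m + ∑[ k < suc b ] shift (suc k) (shift (suc d) (p′ k)) m
    ≡⟨ cong (λ x → p′ (suc b) m + x) (∑-cong (suc b) regroup) ⟩
  p′ (suc b) m + ∑[ k < suc b ] shift (suc (suc d)) (shift k (p′ k)) m
    ≡⟨ cong (λ x → p′ (suc b) m + x) (shift-∑ (suc (suc d)) (suc b) (λ k → shift k (p′ k)) m) ⟨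
  p′ (suc b) m + shift (suc (suc d)) (partitions (suc (suc d)) b) m ∎
  where
  open ≡-Reasoning
  p p′ : ℕ → ℕ → ℕ
  p  = partitions d
  p′ = partitions (suc d)
  regroup : ∀ k → shift (suc k) (shift (suc d) (p′ k)) m ≡ shift (suc (suc d)) (shift k (p′ k)) m
  regroup k = begin
    shift (suc k) (shift (suc d) (p′ k)) m
      ≡⟨ shift-shift (suc k) (suc d) m ⟩
    shift (suc k + suc d) (p′ k) m
      ≡⟨ cong (λ s → shift s (p′ k) m) (trans (+-comm (suc k) (suc d)) (cong suc (+-suc d k))) ⟩
    shift (suc (suc d) + k) (p′ k) m
      ≡⟨ shift-shift (suc (suc d)) k m ⟨
    shift (suc (suc d)) (shift k (p′ k)) m ∎

partitions-mono : ∀ d {b b′} → b ≤ b′ → ∀ m → partitions d b m ≤ partitions d b′ m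
partitions-mono zero    b≤b′ m = ≤-refl
partitions-mono (suc d) b≤b′ m = ∑-prefix-≤ (λ k → shift k (partitions d k) m) (s≤s b≤b′)

partitions≤chains : ∀ d b m → partitions d b m ≤ chains d b m
partitions≤chains zero    b m = ≤-refl
partitions≤chains (suc d) b m = ∑-mono (suc b) (λ k → shift-mono k m (λ x →
  ≤-trans (partitions-mono d (n≤1+n k) x) (partitions≤chains d (suc k) x)))

chains≤partitions : ∀ d b m → chains d b m ≤ partitions d (d + b) (m + triangle d)
chains≤partitions zero    b m = ≤-reflexive (cong δ (sym (+-identityʳ m)))
chains≤partitions (suc d) b m = begin
  ∑[ k < suc b ] shift k (chains d (suc k)) m
    ≤⟨ ∑-mono (suc b) (λ k → shift-mono k m (chains≤partitions d (suc k))) ⟩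
  ∑[ k < suc b ] shift k (λ x → partitions d (d + suc k) (x + triangle d)) m
    ≤⟨ ∑-mono (suc b) (λ k → shift-+ʳ-≤ k {partitions d (d + suc k)} m (triangle d)) ⟩
  ∑[ k < suc b ] shift k (partitions d (d + suc k)) (m + triangle d)
    ≡⟨ ∑-cong (suc b) realign ⟩
  ∑[ k < suc b ] g (suc d + k)
    ≤⟨ ∑-suffix-≤ (suc d) (suc b) g ⟩
  ∑ (suc d + suc b) g
    ≡⟨ cong₂ (λ n x → ∑[ j < n ] shift j (partitions d j) x)
             (+-suc (suc d) b) (+-left-comm (suc d) m (triangle d)) ⟩
  partitions (suc d) (suc d + b) (m + triangle (suc d)) ∎
  where
  open ≤-Reasoning
  g : ℕ → ℕ
  g j = shift j (partitions d j) (suc d + (m + triangle d))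
  realign : ∀ k → shift k (partitions d (d + suc k)) (m + triangle d) ≡ g (suc d + k)
  realign k = trans (cong (λ j → shift k (partitions d j) (m + triangle d)) (+-suc d k))
                    (sym (shift-cancelˡ (suc d) k {partitions d (suc d + k)} (m + triangle d)))

module _ {ℓa ℓp : Level} {A : Set ℓa} {P : Pred A ℓp} (P? : Decidable P) where

  length-filter-concatMap : ∀ {ℓb} {B : Set ℓb} (f : B → List A) xs →
    length (filter P? (concatMap f xs)) ≡ sum (map (λ x → length (filter P? (f x))) xs)
  length-filter-concatMap f []       = refl
  length-filter-concatMap f (x ∷ xs) = begin
    length (filter P? (f x ++ concatMap f xs))
      ≡⟨ cong length (filter-++ P? (f x) _) ⟩
    length (filter P? (f x) ++ filter P? (concatMap f xs))
      ≡⟨ length-++ (filter P? (f x)) ⟩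
    length (filter P? (f x)) + length (filter P? (concatMap f xs))
      ≡⟨ cong (λ n → length (filter P? (f x)) + n) (length-filter-concatMap f xs) ⟩
    sum (map (λ x → length (filter P? (f x))) (x ∷ xs)) ∎
    where open ≡-Reasoning

  length-filter-map : ∀ {ℓb} {B : Set ℓb} (f : B → A) xs →
                      length (filter P? (map f xs)) ≡ length (filter (P? ∘ f) xs)
  length-filter-map f []       = refl
  length-filter-map f (x ∷ xs) with does (P? (f x))
  ... | true  = cong suc (length-filter-map f xs)
  ... | false = length-filter-map f xs

  length-filter-none : (∀ x → ¬ P x) → ∀ xs → length (filter P? xs) ≡ 0
  length-filter-none ¬P xs = cong length (filter-none P? (All.universal ¬P xs))

length-filter-shift : ∀ {ℓa ℓq} {A : Set ℓa} {Q : Pred A ℓq} (Q? : Decidable Q) (s : A → ℕ) k m xs →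
  length (filter (λ x → (k + s x ≟ m) ×-dec Q? x) xs) ≡
  shift k (λ m′ → length (filter (λ x → (s x ≟ m′) ×-dec Q? x) xs)) m
length-filter-shift Q? s zero    m       xs = refl
length-filter-shift Q? s (suc k) zero    xs = length-filter-none _ (λ { x (() , _) }) xs
length-filter-shift Q? s (suc k) (suc m) xs =
  trans (cong length (filter-≐ _ _ ((λ (eq , q) → suc-injective eq , q) , (λ (eq , q) → cong suc eq , q)) xs))
        (length-filter-shift Q? s k m xs)

HeadAtMost : ∀ {d} → ℕ → Vec ℕ d → Set
HeadAtMost b []      = ⊤
HeadAtMost b (k ∷ _) = k ≤ b

headAtMost? : ∀ {d} b (v : Vec ℕ d) → Dec (HeadAtMost b v)
headAtMost? b []      = yes tt
headAtMost? b (k ∷ _) = k ≤? b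

Chain-∷ : ∀ {d} k (v : Vec ℕ d) → Chain (k ∷ v) ⇔ (HeadAtMost (suc k) v × Chain v)
Chain-∷ k []      = mk⇔ (λ _ → tt , tt) (λ _ → tt)
Chain-∷ k (_ ∷ _) = mk⇔ (λ c → c) (λ c → c)

head≤sum : ∀ {d} (v : Vec ℕ d) → HeadAtMost (Vec.sum v) v
head≤sum []      = tt
head≤sum (k ∷ v) = m≤m+n k (Vec.sum v)

ChainTuple : ∀ {d} → ℕ → ℕ → Vec ℕ d → Set
ChainTuple b m v = (Vec.sum v ≡ m) × (HeadAtMost b v × Chain v)

chainTuple? : ∀ {d} b m (v : Vec ℕ d) → Dec (ChainTuple b m v)
chainTuple? b m v = (Vec.sum v ≟ m) ×-dec (headAtMost? b v ×-dec chain? v)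

length-filter-chainTuple : ∀ d M b m → m ≤ M → length (filter (chainTuple? b m) (vecsUpTo d M)) ≡ chains d b m
length-filter-chainTuple zero    M b zero    m≤M = refl
length-filter-chainTuple zero    M b (suc m) m≤M = refl
length-filter-chainTuple (suc d) M b m m≤M = begin
  length (filter (chainTuple? b m) (vecsUpTo (suc d) M))
    ≡⟨ length-filter-concatMap (chainTuple? b m) (λ k → map (k ∷_) vs) (upTo (suc M)) ⟩
  sum (map count (upTo (suc M)))
    ≡⟨ cong sum (map-upTo count (suc M)) ⟩
  ∑ (suc M) count
    ≡⟨ ∑-restrict M b count-head≤b count-head>b (λ k M<k → shift-below k (≤-<-trans m≤M M<k)) ⟩
  chains (suc d) b m ∎
  where
  open ≡-Reasoning
  vs = vecsUpTo d M
  count : ℕ → ℕ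
  count k = length (filter (chainTuple? b m) (map (k ∷_) vs))
  count-head≤b : ∀ k → k ≤ b → count k ≡ shift k (chains d (suc k)) m
  count-head≤b k k≤b = begin
    count k
      ≡⟨ length-filter-map (chainTuple? b m) (k ∷_) vs ⟩
    length (filter (chainTuple? b m ∘ (k ∷_)) vs)
      ≡⟨ cong length (filter-≐ _ _ (cons⇒ , cons⇐) vs) ⟩
    length (filter (λ v → (k + Vec.sum v ≟ m) ×-dec (headAtMost? (suc k) v ×-dec chain? v)) vs)
      ≡⟨ length-filter-shift (λ v → headAtMost? (suc k) v ×-dec chain? v) Vec.sum k m vs ⟩
    shift k (λ m′ → length (filter (chainTuple? (suc k) m′) vs)) m
      ≡⟨ shift-cong k m (λ x x≤m → length-filter-chainTuple d M (suc k) x (≤-trans x≤m m≤M)) ⟩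
    shift k (chains d (suc k)) m ∎
    where
    cons⇒ : ∀ {v} → ChainTuple b m (k ∷ v) → (k + Vec.sum v ≡ m) × (HeadAtMost (suc k) v × Chain v)
    cons⇒ {v} (eq , _ , c) = eq , Equivalence.to (Chain-∷ k v) c
    cons⇐ : ∀ {v} → (k + Vec.sum v ≡ m) × (HeadAtMost (suc k) v × Chain v) → ChainTuple b m (k ∷ v)
    cons⇐ {v} (eq , c) = eq , k≤b , Equivalence.from (Chain-∷ k v) c
  count-head>b : ∀ k → b < k → count k ≡ 0
  count-head>b k b<k = trans (length-filter-map (chainTuple? b m) (k ∷_) vs)
    (length-filter-none _ (λ { v (_ , k≤b , _) → <⇒≱ b<k k≤b }) vs)

a≡chains : ∀ d n → a d n ≡ chains d n n
a≡chains d n = begin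
  length (filter (admissible? d n) (vecsUpTo d n))
    ≡⟨ cong length (filter-≐ _ _ (adm⇒ , adm⇐) (vecsUpTo d n)) ⟩
  length (filter (chainTuple? n n) (vecsUpTo d n))
    ≡⟨ length-filter-chainTuple d n n n ≤-refl ⟩
  chains d n n ∎
  where
  open ≡-Reasoning
  adm⇒ : ∀ {v} → Admissible d n v → ChainTuple n n v
  adm⇒ {v} (eq , c) = eq , subst (λ s → HeadAtMost s v) eq (head≤sum v) , c
  adm⇐ : ∀ {v} → ChainTuple n n v → Admissible d n v
  adm⇐ (eq , _ , c) = eq , c

binomial-upperBound : ∀ x y k → (x + y) ^ suc k ≤ y ^ suc k + suc k * x * (x + y) ^ k
binomial-upperBound x y zero = ≤-reflexive (base x y)
  where
  base : ∀ x y → (x + y) * 1 ≡ y * 1 + 1 * x * 1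
  base = solve-∀
binomial-upperBound x y (suc k) = begin
  (x + y) * (x + y) ^ suc k
    ≤⟨ *-monoʳ-≤ (x + y) (binomial-upperBound x y k) ⟩
  (x + y) * (y ^ suc k + suc k * x * (x + y) ^ k)
    ≡⟨ expand x y (y ^ suc k) ((x + y) ^ k) k ⟩
  y * y ^ suc k + x * y ^ suc k + suc k * x * (x + y) ^ suc k
    ≤⟨ +-monoˡ-≤ _ (+-monoʳ-≤ (y * y ^ suc k) (*-monoʳ-≤ x (^-monoˡ-≤ (suc k) (m≤n+m y x)))) ⟩
  y * y ^ suc k + x * (x + y) ^ suc k + suc k * x * (x + y) ^ suc k
    ≡⟨ collect (y * y ^ suc k) x ((x + y) ^ suc k) k ⟩
  y ^ suc (suc k) + suc (suc k) * x * (x + y) ^ suc k ∎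
  where
  open ≤-Reasoning
  expand : ∀ x y P Q k → (x + y) * (P + suc k * x * Q) ≡ y * P + x * P + suc k * x * ((x + y) * Q)
  expand = solve-∀
  collect : ∀ A x R k → A + x * R + suc k * x * R ≡ A + suc (suc k) * x * R
  collect = solve-∀

binomial-lowerBound : ∀ x y k → y ^ suc k + suc k * x * y ^ k ≤ (x + y) ^ suc k
binomial-lowerBound x y zero = ≤-reflexive (base x y)
  where
  base : ∀ x y → y * 1 + 1 * x * 1 ≡ (x + y) * 1
  base = solve-∀
binomial-lowerBound x y (suc k) = begin
  y * y ^ suc k + suc (suc k) * x * y ^ suc k
    ≡⟨ regroup x y (y ^ k) k ⟩
  (x + y) * y ^ suc k + suc k * x * (y * y ^ k)
    ≤⟨ +-monoʳ-≤ ((x + y) * y ^ suc k) (*-monoʳ-≤ (suc k * x) (*-monoˡ-≤ (y ^ k) (m≤n+m y x))) ⟩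
  (x + y) * y ^ suc k + suc k * x * ((x + y) * y ^ k)
    ≡⟨ factor x y (y ^ k) k ⟩
  (x + y) * (y ^ suc k + suc k * x * y ^ k)
    ≤⟨ *-monoʳ-≤ (x + y) (binomial-lowerBound x y k) ⟩
  (x + y) * (x + y) ^ suc k ∎
  where
  open ≤-Reasoning
  regroup : ∀ x y P k → y * (y * P) + suc (suc k) * x * (y * P) ≡ (x + y) * (y * P) + suc k * x * (y * P)
  regroup = solve-∀
  factor : ∀ x y P k → (x + y) * (y * P) + suc k * x * ((x + y) * P) ≡ (x + y) * (y * P + suc k * x * P)
  factor = solve-∀

[x+n]^k≤[1+x]^k*n^k : ∀ x {n} k → 1 ≤ n → (x + n) ^ k ≤ suc x ^ k * n ^ k
[x+n]^k≤[1+x]^k*n^k x     zero    1≤n = ≤-refl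
[x+n]^k≤[1+x]^k*n^k x {n@(suc _)} (suc k) 1≤n = begin
  (x + n) * (x + n) ^ k             ≤⟨ *-mono-≤ x+n≤[1+x]*n ([x+n]^k≤[1+x]^k*n^k x k 1≤n) ⟩
  (suc x * n) * (suc x ^ k * n ^ k)  ≡⟨ interchange (suc x) n (suc x ^ k) (n ^ k) ⟩
  suc x ^ suc k * n ^ suc k          ∎
  where
  open ≤-Reasoning
  x+n≤[1+x]*n : x + n ≤ suc x * n
  x+n≤[1+x]*n = ≤-trans (≤-reflexive (+-comm x n)) (+-monoʳ-≤ n (m≤m*n x n))
  interchange : ∀ a b c d → (a * b) * (c * d) ≡ (a * c) * (b * d)
  interchange = solve-∀

binomial-upperBound′ : ∀ x {n} k → 1 ≤ n → (x + n) ^ k * n ≤ n ^ suc k + suc k * x * suc x ^ k * n ^ k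
binomial-upperBound′ x {n} k 1≤n = begin
  (x + n) ^ k * n
    ≤⟨ ≤-trans (≤-reflexive (*-comm _ n)) (*-monoˡ-≤ _ (m≤n+m n x)) ⟩
  (x + n) ^ suc k
    ≤⟨ binomial-upperBound x n k ⟩
  n ^ suc k + suc k * x * (x + n) ^ k
    ≤⟨ +-monoʳ-≤ (n ^ suc k) (*-monoʳ-≤ (suc k * x) ([x+n]^k≤[1+x]^k*n^k x k 1≤n)) ⟩
  n ^ suc k + suc k * x * (suc x ^ k * n ^ k)
    ≡⟨ cong (λ y → n ^ suc k + y) (*-assoc (suc k * x) (suc x ^ k) (n ^ k)) ⟨
  n ^ suc k + suc k * x * suc x ^ k * n ^ k ∎
  where open ≤-Reasoning

K : ℕ → ℕ
K e = suc e ! * e !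

K-suc : ∀ e x → K (suc e) * x ≡ suc e * suc (suc e) * (K e * x)
K-suc e x = regroup (suc (suc e)) (suc e) (e !) x
  where
  regroup : ∀ t s f x → t * (s * f) * (s * f) * x ≡ s * t * (s * f * f * x)
  regroup = solve-∀

partitions-one-≤ : ∀ b m → partitions 1 b m ≤ 1
partitions-one-≤ zero    zero    = ≤-refl
partitions-one-≤ zero    (suc m) = z≤n
partitions-one-≤ (suc b) zero    = ≤-reflexive (partitions-pascal 0 b 0)
partitions-one-≤ (suc b) (suc m) = ≤-trans (≤-reflexive (partitions-pascal 0 b (suc m))) (partitions-one-≤ b m)

partitions-one-≥ : ∀ b m → m ≤ b → 1 ≤ partitions 1 b m
partitions-one-≥ zero    zero    m≤b = ≤-refl
partitions-one-≥ (suc b) zero    m≤b = ≤-reflexive (sym (partitions-pascal 0 b 0))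
partitions-one-≥ (suc b) (suc m) m≤b =
  ≤-trans (partitions-one-≥ b m (s≤s⁻¹ m≤b)) (≤-reflexive (sym (partitions-pascal 0 b (suc m))))

partitions-lowerBound : ∀ e b m → m ≤ b → m ^ e ≤ K e * partitions (suc e) b m
partitions-lowerBound zero b m m≤b = ≤-trans (partitions-one-≥ b m m≤b) (m≤m+n _ 0)
partitions-lowerBound (suc e) zero    zero m≤b = z≤n
partitions-lowerBound (suc e) (suc b) m m≤b with ≤-<-connex (suc (suc e)) m
... | inj₂ m<t = begin
  m * m ^ e
    ≤⟨ *-monoˡ-≤ (m ^ e) (≤-trans (s≤s⁻¹ m<t) (m≤m*n (suc e) (suc (suc e)))) ⟩
  suc e * suc (suc e) * m ^ e
    ≤⟨ *-monoʳ-≤ (suc e * suc (suc e)) (partitions-lowerBound e (suc b) m m≤b) ⟩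
  suc e * suc (suc e) * (K e * partitions (suc e) (suc b) m)
    ≡⟨ K-suc e _ ⟨
  K (suc e) * partitions (suc e) (suc b) m
    ≤⟨ *-monoʳ-≤ (K (suc e)) (m≤m+n _ _) ⟩
  K (suc e) * (partitions (suc e) (suc b) m + shift (suc (suc e)) (partitions (suc (suc e)) b) m)
    ≡⟨ cong (K (suc e) *_) (partitions-pascal (suc e) b m) ⟨
  K (suc e) * partitions (suc (suc e)) (suc b) m ∎
  where open ≤-Reasoning
... | inj₁ t≤m with m≤n⇒∃[o]m+o≡n t≤m
... | y , refl = begin
  m ^ suc e
    ≤⟨ binomial-upperBound t y e ⟩
  y ^ suc e + suc e * t * m ^ e
    ≤⟨ +-mono-≤ (partitions-lowerBound (suc e) b y y≤b)
                (*-monoʳ-≤ (suc e * t) (partitions-lowerBound e (suc b) m m≤b)) ⟩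
  K (suc e) * partitions t b y + suc e * t * (K e * partitions (suc e) (suc b) m)
    ≡⟨ cong₂ _+_ (cong (K (suc e) *_) (shift-+ˡ t y)) (K-suc e _) ⟨
  K (suc e) * B + K (suc e) * A
    ≡⟨ trans (*-distribˡ-+ (K (suc e)) A B) (+-comm (K (suc e) * A) (K (suc e) * B)) ⟨
  K (suc e) * (A + B)
    ≡⟨ cong (K (suc e) *_) (partitions-pascal (suc e) b m) ⟨
  K (suc e) * partitions t (suc b) m ∎
  where
  open ≤-Reasoning
  t = suc (suc e)
  A = partitions (suc e) (suc b) m
  B = shift t (partitions t b) m
  y≤b : y ≤ b
  y≤b = m+n≤o⇒n≤o (suc e) (s≤s⁻¹ m≤b)

partitions-upperBound : ∀ e b m → K e * partitions (suc e) b m ≤ (m + triangle (suc e)) ^ e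
partitions-upperBound zero b m = ≤-trans (≤-reflexive (+-identityʳ _)) (partitions-one-≤ b m)
partitions-upperBound (suc e) b m = begin
  K (suc e) * partitions t b m       ≤⟨ pascal-bound b ⟩
  w ^ suc e + suc e * t * w ^ e      ≤⟨ binomial-lowerBound t w e ⟩
  (t + w) ^ suc e                    ≡⟨ cong (_^ suc e) (+-left-comm t m (triangle (suc e))) ⟩
  (m + triangle t) ^ suc e           ∎
  where
  open ≤-Reasoning
  t = suc (suc e)
  w = m + triangle (suc e)
  fewer-parts-bound : ∀ b → K (suc e) * partitions (suc e) b m ≤ suc e * t * w ^ e
  fewer-parts-bound b = begin
    K (suc e) * partitions (suc e) b m            ≡⟨ K-suc e _ ⟩
    suc e * t * (K e * partitions (suc e) b m)    ≤⟨ *-monoʳ-≤ (suc e * t) (partitions-upperBound e b m) ⟩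
    suc e * t * w ^ e                             ∎
  pascal-bound : ∀ b → K (suc e) * partitions t b m ≤ w ^ suc e + suc e * t * w ^ e
  pascal-bound zero = begin
    K (suc e) * partitions t 0 m          ≡⟨ cong (K (suc e) *_) (partitions-zero (suc e) m) ⟩
    K (suc e) * partitions (suc e) 0 m    ≤⟨ fewer-parts-bound 0 ⟩
    suc e * t * w ^ e                     ≤⟨ m≤n+m (suc e * t * w ^ e) (w ^ suc e) ⟩
    w ^ suc e + suc e * t * w ^ e         ∎
  pascal-bound (suc b) = begin
    K (suc e) * partitions t (suc b) m
      ≡⟨ cong (K (suc e) *_) (partitions-pascal (suc e) b m) ⟩
    K (suc e) * (partitions (suc e) (suc b) m + shift t (partitions t b) m)
      ≡⟨ *-distribˡ-+ (K (suc e)) _ _ ⟩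
    K (suc e) * partitions (suc e) (suc b) m + K (suc e) * shift t (partitions t b) m
      ≤⟨ +-mono-≤ (fewer-parts-bound (suc b))
                  (≤-trans (≤-reflexive (*-shift (K (suc e)) t m))
                           (shift-≤ t {g = λ x → (x + triangle (suc e)) ^ suc e} m more-parts-bound)) ⟩
    suc e * t * w ^ e + w ^ suc e
      ≡⟨ +-comm (suc e * t * w ^ e) (w ^ suc e) ⟩
    w ^ suc e + suc e * t * w ^ e ∎
    where
    more-parts-bound : ∀ x → K (suc e) * partitions t b x ≤ (t + x + triangle (suc e)) ^ suc e
    more-parts-bound x = ≤-trans (partitions-upperBound (suc e) b x)
      (≤-reflexive (cong (_^ suc e) (trans (+-left-comm x t (triangle (suc e))) (sym (+-assoc t x _)))))

∣+m-+n∣≤o : ∀ {m n o} → n ≤ m → m ≤ n + o → ∣ + m - + n ∣ ≤ o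
∣+m-+n∣≤o {m} {n} n≤m m≤n+o rewrite ℤ.m-n≡m⊖n m n | ℤ.⊖-≥ n≤m = m≤n+o⇒m∸n≤o m n m≤n+o

a-lowerBound : ∀ e n → n ^ e ≤ K e * a (suc e) n
a-lowerBound e n = begin
  n ^ e                               ≤⟨ partitions-lowerBound e n n ≤-refl ⟩
  K e * partitions (suc e) n n        ≤⟨ *-monoʳ-≤ (K e) (partitions≤chains (suc e) n n) ⟩
  K e * chains (suc e) n n            ≡⟨ cong (K e *_) (a≡chains (suc e) n) ⟨
  K e * a (suc e) n                   ∎
  where open ≤-Reasoning

a-upperBound : ∀ e n → K e * a (suc e) n ≤ (triangle (suc e) + triangle (suc e) + n) ^ e
a-upperBound e n = begin
  K e * a (suc e) n
    ≡⟨ cong (K e *_) (a≡chains (suc e) n) ⟩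
  K e * chains (suc e) n n
    ≤⟨ *-monoʳ-≤ (K e) (chains≤partitions (suc e) n n) ⟩
  K e * partitions (suc e) (suc e + n) (n + triangle (suc e))
    ≤⟨ partitions-upperBound e (suc e + n) (n + triangle (suc e)) ⟩
  (n + triangle (suc e) + triangle (suc e)) ^ e
    ≡⟨ cong (_^ e) (trans (+-assoc n _ _) (+-comm n _)) ⟩
  (triangle (suc e) + triangle (suc e) + n) ^ e ∎
  where open ≤-Reasoning

lemma4 : (d : ℕ) → 1 ≤ d → ∃₂ λ (C N : ℕ) → ∀ n → N ≤ n → ∣ + ((d !) * ((d ∸ 1) !) * a d n * n) - + (n ^ d) ∣ ≤ C * n ^ (d ∸ 1)
lemma4 (suc e) _ = suc e * E * suc E ^ e , 1 , λ n 1≤n → ∣+m-+n∣≤o (lower n) (upper n 1≤n)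
  where
  E = triangle (suc e) + triangle (suc e)
  lower : ∀ n → n ^ suc e ≤ K e * a (suc e) n * n
  lower n = ≤-trans (≤-reflexive (*-comm n (n ^ e))) (*-monoˡ-≤ n (a-lowerBound e n))
  upper : ∀ n → 1 ≤ n → K e * a (suc e) n * n ≤ n ^ suc e + suc e * E * suc E ^ e * n ^ e
  upper n 1≤n = ≤-trans (*-monoˡ-≤ n (a-upperBound e n)) (binomial-upperBound′ E e 1≤n)
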